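{- For every integer $n\ge 1$, let $\operatorname{Reg}_n=\{a\in\mathbb{Z}: 1\le a\le n,\ \exists x\in\mathbb{Z} \text{ with } a^2x\equiv a \pmod n\}$, let $\varrho(n)=\#\operatorname{Reg}_n$, and let $S(n)=\sum_{a\in \operatorname{Reg}_n} a$. Then for every $n\ge 1$, \[ S(n)=\frac{n(\varrho(n)+1)}{2}. \]
   Context: An integer $a$ is called regular (mod $n$) if there is an integer $x$ with $a^2x\equiv a \pmod n$. $\varrho(n)$ is the number of regular integers (mod $n$) in $\{1,\dots,n\}$ and $S(n)$ is their sum. -}

module Defs where

open import Data.Nat using (ℕ; zero; suc; _+_)
open import Data.Integer using (ℤ; +_; _*_; _-_)
open import Data.Integer.Divisibility using (_∣_)
open import Data.Product using (∃)
open import Relation.Nullary using (Dec; yes; no)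

Regular : ℕ → ℤ → Set
Regular n a = ∃ λ (x : ℤ) → (+ n) ∣ ((a * a * x) - a)

module _ (n : ℕ) (dec : (a : ℤ) → Dec (Regular n a)) where

  countUpTo : ℕ → ℕ
  countUpTo zero = zero
  countUpTo (suc k) with dec (+ suc k)
  ... | yes _ = suc (countUpTo k)
  ... | no  _ = countUpTo k

  sumUpTo : ℕ → ℕ
  sumUpTo zero = zero
  sumUpTo (suc k) with dec (+ suc k)
  ... | yes _ = suc k + sumUpTo k
  ... | no  _ = sumUpTo k

  ϱ : ℕ
  ϱ = countUpTo n

  S : ℕ
  S = sumUpTo n

{-# OPTIONS --safe #-}
-- The map a ↦ n − a preserves regularity (take −x for x), so it is an
-- involution of Reg_n ∩ {1, …, n − 1} pairing a with n − a; hence the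
-- regular integers below n sum to n/2 times their number. Finally n itself
-- is regular (as 0 is) and contributes n to S(n) and 1 to ϱ(n).
module Submission where

open import Defs
open import Data.Nat using (ℕ; _+_; _*_; _≥_; zero; suc; _∸_; _≤_)
open import Data.Nat.Properties as ℕ
  using (≤-refl; m≤n⇒m≤1+n; *-zeroʳ; *-identityʳ;
         *-distribˡ-+; *-distribʳ-+; m+[n∸m]≡n; m∸n≤m; m∸[m∸n]≡n)
open import Data.Nat.Tactic.RingSolver as ℕ-Solver using ()
open import Data.Integer as ℤ using (ℤ; +_; -_)
open import Data.Integer.Properties as ℤ using (m-n≡m⊖n; ⊖-≥)
open import Data.Integer.Divisibility.Signed
  using (_∣_; ∣ᵤ⇒∣; ∣⇒∣ᵤ; ∣-refl; ∣m⇒∣-m; ∣m∣n⇒∣m+n; ∣n⇒∣m*n)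
open import Data.Integer.Tactic.RingSolver as ℤ-Solver using ()
open import Algebra.Properties.CommutativeSemigroup ℕ.+-commutativeSemigroup
  using (x∙yz≈y∙xz; interchange)
open import Data.Product using (_,_)
open import Data.Empty using (⊥-elim)
open import Relation.Nullary using (Dec; yes; no)
open import Relation.Binary.PropositionalEquality
  using (_≡_; refl; sym; trans; cong; cong₂; subst; module ≡-Reasoning)

open ≡-Reasoning

Regular-neg : ∀ {n a} → Regular n a → Regular n (- a)
Regular-neg {n} {a} (x , n∣r) =
  - x , ∣⇒∣ᵤ (subst (+ n ∣_) (negate a x) (∣m⇒∣-m (∣ᵤ⇒∣ n∣r)))
  where
  negate : ∀ a x → - (a ℤ.* a ℤ.* x ℤ.- a) ≡ - a ℤ.* - a ℤ.* - x ℤ.- - a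
  negate = ℤ-Solver.solve-∀

Regular-+n : ∀ {n a} → Regular n a → Regular n (a ℤ.+ + n)
Regular-+n {n} {a} (x , n∣r) =
  x , ∣⇒∣ᵤ (subst (+ n ∣_) (expand a (+ n) x)
              (∣m∣n⇒∣m+n {m = a ℤ.* a ℤ.* x ℤ.- a} (∣ᵤ⇒∣ n∣r)
                 (∣n⇒∣m*n (+ 2 ℤ.* a ℤ.* x ℤ.+ + n ℤ.* x ℤ.- + 1) ∣-refl)))
  where
  expand : ∀ a N x →
    a ℤ.* a ℤ.* x ℤ.- a ℤ.+ (+ 2 ℤ.* a ℤ.* x ℤ.+ N ℤ.* x ℤ.- + 1) ℤ.* N
      ≡ (a ℤ.+ N) ℤ.* (a ℤ.+ N) ℤ.* x ℤ.- (a ℤ.+ N)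
  expand = ℤ-Solver.solve-∀

Regular-0 : ∀ n → Regular n (+ 0)
Regular-0 n = + 0 , ∣⇒∣ᵤ (∣n⇒∣m*n (+ 0) (∣-refl {+ n}))

Regular-self : ∀ n → Regular n (+ n)
Regular-self n = subst (Regular n) (ℤ.+-identityˡ (+ n)) (Regular-+n {a = + 0} (Regular-0 n))

Regular-reflect : ∀ {n a} → a ≤ n → Regular n (+ a) → Regular n (+ (n ∸ a))
Regular-reflect {n} {a} a≤n reg =
  subst (Regular n) reflection (Regular-+n {a = - + a} (Regular-neg {a = + a} reg))
  where
  reflection : - + a ℤ.+ + n ≡ + (n ∸ a)
  reflection = begin
    - + a ℤ.+ + n  ≡⟨ ℤ.+-comm (- + a) (+ n) ⟩
    + n ℤ.- + a    ≡⟨ m-n≡m⊖n n a ⟩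
    n ℤ.⊖ a        ≡⟨ ⊖-≥ a≤n ⟩
    + (n ∸ a)      ∎

∑ : ℕ → (ℕ → ℕ) → ℕ
∑ zero    f = 0
∑ (suc m) f = f (suc m) + ∑ m f

∑-cong : ∀ m {f g : ℕ → ℕ} → (∀ {a} → a ≤ m → f a ≡ g a) → ∑ m f ≡ ∑ m g
∑-cong zero    f≗g = refl
∑-cong (suc m) f≗g = cong₂ _+_ (f≗g ≤-refl) (∑-cong m (λ a≤m → f≗g (m≤n⇒m≤1+n a≤m)))

∑-suc : ∀ m (f : ℕ → ℕ) → ∑ (suc m) f ≡ f 1 + ∑ m (λ a → f (suc a))
∑-suc zero    f = refl
∑-suc (suc m) f = begin
  f (2 + m) + ∑ (suc m) f                      ≡⟨ cong (_+_ (f (2 + m))) (∑-suc m f) ⟩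
  f (2 + m) + (f 1 + ∑ m (λ a → f (suc a)))    ≡⟨ x∙yz≈y∙xz (f (2 + m)) (f 1) _ ⟩
  f 1 + (f (2 + m) + ∑ m (λ a → f (suc a)))    ∎

∑-reverse : ∀ m (f : ℕ → ℕ) → ∑ m f ≡ ∑ m (λ a → f (suc m ∸ a))
∑-reverse zero    f = refl
∑-reverse (suc m) f = sym (begin
  ∑ (suc m) (λ a → f (2 + m ∸ a))          ≡⟨ ∑-suc m (λ a → f (2 + m ∸ a)) ⟩
  f (suc m) + ∑ m (λ a → f (suc m ∸ a))    ≡⟨ cong (_+_ (f (suc m))) (∑-reverse m f) ⟨
  f (suc m) + ∑ m f                        ∎)

∑-distrib-+ : ∀ m (f g : ℕ → ℕ) → ∑ m (λ a → f a + g a) ≡ ∑ m f + ∑ m g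
∑-distrib-+ zero    f g = refl
∑-distrib-+ (suc m) f g = begin
  f (suc m) + g (suc m) + ∑ m (λ a → f a + g a)  ≡⟨ cong (_+_ (f (suc m) + g (suc m))) (∑-distrib-+ m f g) ⟩
  f (suc m) + g (suc m) + (∑ m f + ∑ m g)        ≡⟨ interchange (f (suc m)) (g (suc m)) (∑ m f) (∑ m g) ⟩
  f (suc m) + ∑ m f + (g (suc m) + ∑ m g)        ∎

∑-distribˡ-* : ∀ m c (f : ℕ → ℕ) → ∑ m (λ a → c * f a) ≡ c * ∑ m f
∑-distribˡ-* zero    c f = sym (*-zeroʳ c)
∑-distribˡ-* (suc m) c f = begin
  c * f (suc m) + ∑ m (λ a → c * f a)  ≡⟨ cong (_+_ (c * f (suc m))) (∑-distribˡ-* m c f) ⟩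
  c * f (suc m) + c * ∑ m f            ≡⟨ *-distribˡ-+ c (f (suc m)) (∑ m f) ⟨
  c * (f (suc m) + ∑ m f)              ∎

∑-symmetric-weighted : ∀ m (w : ℕ → ℕ) → (∀ {a} → a ≤ m → w (suc m ∸ a) ≡ w a) →
  ∑ m (λ a → a * w a) + ∑ m (λ a → a * w a) ≡ suc m * ∑ m w
∑-symmetric-weighted m w w-sym = begin
  s + s                                                 ≡⟨ cong (_+_ s) (∑-reverse m (λ a → a * w a)) ⟩
  s + ∑ m (λ a → (suc m ∸ a) * w (suc m ∸ a))           ≡⟨ cong (_+_ s) (∑-cong m (λ {a} a≤m → cong ((suc m ∸ a) *_) (w-sym a≤m))) ⟩
  s + ∑ m (λ a → (suc m ∸ a) * w a)                     ≡⟨ ∑-distrib-+ m (λ a → a * w a) (λ a → (suc m ∸ a) * w a) ⟨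
  ∑ m (λ a → a * w a + (suc m ∸ a) * w a)               ≡⟨ ∑-cong m pair ⟩
  ∑ m (λ a → suc m * w a)                               ≡⟨ ∑-distribˡ-* m (suc m) w ⟩
  suc m * ∑ m w                                         ∎
  where
  s : ℕ
  s = ∑ m (λ a → a * w a)
  pair : ∀ {a} → a ≤ m → a * w a + (suc m ∸ a) * w a ≡ suc m * w a
  pair {a} a≤m = trans (sym (*-distribʳ-+ (w a) a (suc m ∸ a)))
                       (cong (_* w a) (m+[n∸m]≡n (m≤n⇒m≤1+n a≤m)))

indicator : {P : Set} → Dec P → ℕ
indicator (yes _) = 1
indicator (no  _) = 0

module _ (n : ℕ) (dec : (a : ℤ) → Dec (Regular n a)) where

  χReg : ℕ → ℕ
  χReg a = indicator (dec (+ a))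

  countUpTo≡∑ : ∀ k → countUpTo n dec k ≡ ∑ k χReg
  countUpTo≡∑ zero = refl
  countUpTo≡∑ (suc k) with dec (+ suc k)
  ... | yes _ = cong suc (countUpTo≡∑ k)
  ... | no  _ = countUpTo≡∑ k

  sumUpTo≡∑ : ∀ k → sumUpTo n dec k ≡ ∑ k (λ a → a * χReg a)
  sumUpTo≡∑ zero = refl
  sumUpTo≡∑ (suc k) with dec (+ suc k)
  ... | yes _ = cong₂ _+_ (sym (*-identityʳ (suc k))) (sumUpTo≡∑ k)
  ... | no  _ = cong₂ _+_ (sym (*-zeroʳ (suc k))) (sumUpTo≡∑ k)

  χReg-self : χReg n ≡ 1
  χReg-self with dec (+ n)
  ... | yes _   = refl
  ... | no  ¬ru = ⊥-elim (¬ru (Regular-self n))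

  χReg-reflect : ∀ {a} → a ≤ n → χReg (n ∸ a) ≡ χReg a
  χReg-reflect {a} a≤n with dec (+ a) | dec (+ (n ∸ a))
  ... | yes _  | yes _   = refl
  ... | no  _  | no  _   = refl
  ... | yes ra | no ¬rna = ⊥-elim (¬rna (Regular-reflect a≤n ra))
  ... | no ¬ra | yes rna = ⊥-elim (¬ra (subst (λ b → Regular n (+ b)) (m∸[m∸n]≡n a≤n)
                                              (Regular-reflect (m∸n≤m n a) rna)))

theorem3 : (n : ℕ) → n ≥ 1 → (dec : (a : ℤ) → Dec (Regular n a)) →
    2 * S n dec ≡ n * (ϱ n dec + 1)
theorem3 n@(suc m) _ dec = begin
  2 * S n dec                 ≡⟨ cong (2 *_) (sumUpTo≡∑ n dec n) ⟩
  2 * (n * r n + s)           ≡⟨ cong (λ t → 2 * (n * t + s)) (χReg-self n dec) ⟩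
  2 * (n * 1 + s)             ≡⟨ double n s ⟩
  n * 2 + (s + s)             ≡⟨ cong (_+_ (n * 2)) pairing ⟩
  n * 2 + n * c               ≡⟨ factor n c ⟩
  n * (1 + c + 1)             ≡⟨ cong (λ t → n * (t + c + 1)) (χReg-self n dec) ⟨
  n * (r n + c + 1)           ≡⟨ cong (λ t → n * (t + 1)) (countUpTo≡∑ n dec n) ⟨
  n * (ϱ n dec + 1)           ∎
  where
  r : ℕ → ℕ
  r = χReg n dec
  s c : ℕ
  s = ∑ m (λ a → a * r a)
  c = ∑ m r
  pairing : s + s ≡ n * c
  pairing = ∑-symmetric-weighted m r
    (λ a≤m → χReg-reflect n dec (m≤n⇒m≤1+n a≤m))
  double : ∀ n s → 2 * (n * 1 + s) ≡ n * 2 + (s + s)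
  double = ℕ-Solver.solve-∀
  factor : ∀ n c → n * 2 + n * c ≡ n * (1 + c + 1)
  factor = ℕ-Solver.solve-∀
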